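{- Let $\mathfrak A$ be a structure and $k>1$ an integer. Then $\mathfrak A^{\mathrm{per}}\cong(\mathfrak A^{\mathrm{per}})^k$.
   Context: A function $\vec a:\mathbb N\to A$ is periodic if for some $k\ge1$, $\vec a(i)=\vec a(i\bmod k)$ for all $i$. The periodic power $\mathfrak A^{\mathrm{per}}$ is the substructure of the direct power $\mathfrak A^{\mathbb N}$ on the periodic functions; $(\cdot)^k$ denotes the $k$-th direct power. -}

module Defs where

open import Level using (0ℓ)
open import Data.Nat using (ℕ; zero; suc; _+_; _*_; _%_; _/_)
open import Data.Nat.DivMod using (m≡m%n+[m/n]*n; %-remove-+ʳ)
open import Data.Nat.Divisibility using (_∣_; ∣-refl; ∣-trans; n∣m*n; m∣m*n; divides)
open import Data.Fin using (Fin; zero; suc)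
open import Data.Product using (Σ; _,_; proj₁; proj₂)
open import Function using (_∘_; _⇔_)
open import Relation.Binary.Bundles using (Setoid)
open import Relation.Binary.PropositionalEquality as P using (_≡_)

record Signature : Set₁ where
  field
    Fun      : Set
    funArity : Fun → ℕ
    Rel      : Set
    relArity : Rel → ℕ

record Structure (σ : Signature) : Set₁ where
  open Signature σ
  field
    setoid : Setoid 0ℓ 0ℓ
  open Setoid setoid public
  field
    fun      : (f : Fun) → (Fin (funArity f) → Carrier) → Carrier
    fun-cong : ∀ f {xs ys : Fin (funArity f) → Carrier} →
               (∀ j → xs j ≈ ys j) → fun f xs ≈ fun f ys
    rel      : (r : Rel) → (Fin (relArity r) → Carrier) → Set
    rel-resp : ∀ r {xs ys : Fin (relArity r) → Carrier} →
               (∀ j → xs j ≈ ys j) → rel r xs → rel r ys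

power : ∀ {σ} → Set → Structure σ → Structure σ
power {σ} I A = record
  { setoid   = record
      { Carrier       = I → Carrier
      ; _≈_           = λ a b → ∀ i → a i ≈ b i
      ; isEquivalence = record
          { refl  = λ i → refl
          ; sym   = λ p i → sym (p i)
          ; trans = λ p q i → trans (p i) (q i) } }
  ; fun      = λ f xs i → fun f (λ j → xs j i)
  ; fun-cong = λ f p i → fun-cong f (λ j → p j i)
  ; rel      = λ r xs → ∀ i → rel r (λ j → xs j i)
  ; rel-resp = λ r p h i → rel-resp r (λ j → p j i) (h i)
  }
  where open Structure A

substructure : ∀ {σ} (A : Structure σ) (S : Structure.Carrier A → Set) →
  (∀ {a b} → Structure._≈_ A a b → S a → S b) →
  (∀ f (xs : Fin (Signature.funArity σ f) → Structure.Carrier A) →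
     (∀ j → S (xs j)) → S (Structure.fun A f xs)) →
  Structure σ
substructure {σ} A S _ closed = record
  { setoid   = record
      { Carrier       = Σ Carrier S
      ; _≈_           = λ a b → proj₁ a ≈ proj₁ b
      ; isEquivalence = record { refl = refl ; sym = sym ; trans = trans } }
  ; fun      = λ f xs → fun f (proj₁ ∘ xs) , closed f (proj₁ ∘ xs) (proj₂ ∘ xs)
  ; fun-cong = λ f p → fun-cong f p
  ; rel      = λ r xs → rel r (proj₁ ∘ xs)
  ; rel-resp = λ r p → rel-resp r p
  }
  where open Structure A

-- Periodic functions ℕ → A:  a(i) = a(i mod k) for some k ≥ 1 (k = suc m)

Periodic : ∀ {σ} (A : Structure σ) → (ℕ → Structure.Carrier A) → Set
Periodic A a = Σ ℕ λ m → ∀ i → a i ≈ a (i % suc m)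
  where open Structure A

private
  mod-mod : ∀ i p P → suc p ∣ suc P → (i % suc P) % suc p ≡ i % suc p
  mod-mod i p P d = P.sym (P.trans
    (P.cong (_% suc p) (m≡m%n+[m/n]*n i (suc P)))
    (%-remove-+ʳ (i % suc P) (∣-trans d (n∣m*n (i / suc P)))))

  -- prodP n ms satisfies suc (prodP n ms) = ∏_j suc (ms j)
  prodP : ∀ n → (Fin n → ℕ) → ℕ
  prodP zero    ms = 0
  prodP (suc n) ms = let B = prodP n (ms ∘ suc) in B + ms zero * suc B

  prodP-∣ : ∀ n ms (j : Fin n) → suc (ms j) ∣ suc (prodP n ms)
  prodP-∣ (suc n) ms zero    = m∣m*n (suc (prodP n (ms ∘ suc)))
  prodP-∣ (suc n) ms (suc j) =
    ∣-trans (prodP-∣ n (ms ∘ suc) j) (n∣m*n (suc (ms zero)))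

periodic-resp : ∀ {σ} (A : Structure σ) {a b : ℕ → Structure.Carrier A} →
  (∀ i → Structure._≈_ A (a i) (b i)) → Periodic A a → Periodic A b
periodic-resp A {a} {b} p (m , q) =
  m , λ i → trans (sym (p i)) (trans (q i) (p (i % suc m)))
  where open Structure A

periodic-closed : ∀ {σ} (A : Structure σ) f
  (xs : Fin (Signature.funArity σ f) → ℕ → Structure.Carrier A) →
  (∀ j → Periodic A (xs j)) → Periodic A (Structure.fun (power ℕ A) f xs)
periodic-closed {σ} A f xs per =
  M , λ i → fun-cong f (λ j → lemma j i)
  where
  open Structure A
  n = Signature.funArity σ f
  M = prodP n (proj₁ ∘ per)
  lemma : ∀ j i → xs j i ≈ xs j (i % suc M)
  lemma j i = trans (proj₂ (per j) i)
    (trans (reflexive (P.cong (xs j) (P.sym (mod-mod i (proj₁ (per j)) M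
                                                 (prodP-∣ n (proj₁ ∘ per) j)))))
           (sym (proj₂ (per j) (i % suc M))))

periodicPower : ∀ {σ} → Structure σ → Structure σ
periodicPower A =
  substructure (power ℕ A) (Periodic A) (periodic-resp A) (periodic-closed A)

record _≅_ {σ} (A B : Structure σ) : Set where
  open Signature σ
  private
    module A = Structure A
    module B = Structure B
  field
    to       : A.Carrier → B.Carrier
    from     : B.Carrier → A.Carrier
    to-cong  : ∀ {x y} → x A.≈ y → to x B.≈ to y
    from-cong : ∀ {x y} → x B.≈ y → from x A.≈ from y
    from-to  : ∀ x → from (to x) A.≈ x
    to-from  : ∀ y → to (from y) B.≈ y
    to-fun   : ∀ f (xs : Fin (funArity f) → A.Carrier) →
               to (A.fun f xs) B.≈ B.fun f (to ∘ xs)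
    to-rel   : ∀ r (xs : Fin (relArity r) → A.Carrier) →
               A.rel r xs ⇔ B.rel r (to ∘ xs)

-- A periodic sequence splits into its k subsequences along the residue classes
-- mod k, and each of them is periodic with the same period.  Conversely, k
-- periodic sequences with periods p₀, …, p_{k-1} interleave into a sequence of
-- period k · ∏ⱼ pⱼ.  These two maps are mutually inverse, and since operations
-- and relations act pointwise on both sides, they form an isomorphism.
module Submission where

open import Defs
open import Data.Nat using (ℕ; zero; suc; _+_; _*_; _%_; _/_; _<_; NonZero)
open import Data.Nat.DivMod
  using (_mod_; _divMod_; module DivMod; m%n<n; m<n⇒m%n≡m; m<n⇒m/n≡0; [m+kn]%n≡m%n;
         m*n/n≡m; +-distrib-/-∣ʳ; m≡m%n+[m/n]*n; m∣n⇒o%n%m≡o%m; m%[n*o]/o≡m/o%n)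
open import Data.Nat.Divisibility using (_∣_; ∣-trans; n∣m*n; m∣m*n; divides-refl)
open import Data.Nat.Tactic.RingSolver using (solve-∀)
open import Data.Fin using (Fin; toℕ; zero; suc)
open import Data.Fin.Properties using (toℕ-fromℕ<; toℕ-injective; toℕ<n)
open import Data.Product using (_,_; proj₁; proj₂)
open import Function using (_∘_; mk⇔)
open import Relation.Binary.PropositionalEquality
  using (_≡_; sym; cong; cong₂; module ≡-Reasoning)
import Relation.Binary.Reasoning.Setoid as SetoidReasoning

module Interleaving (k : ℕ) .{{_ : NonZero k}} where

  interleave : Fin k → ℕ → ℕ
  interleave r i = toℕ r + i * k

  interleave-mod-/ : ∀ n → interleave (n mod k) (n / k) ≡ n
  interleave-mod-/ n = sym (DivMod.property (n divMod k))

  interleave-mod : ∀ r i → interleave r i mod k ≡ r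
  interleave-mod r i = toℕ-injective (begin
    toℕ (interleave r i mod k) ≡⟨ toℕ-fromℕ< (m%n<n (interleave r i) k) ⟩
    interleave r i % k         ≡⟨ [m+kn]%n≡m%n (toℕ r) i k ⟩
    toℕ r % k                  ≡⟨ m<n⇒m%n≡m (toℕ<n r) ⟩
    toℕ r                      ∎)
    where open ≡-Reasoning

  interleave-/ : ∀ r i → interleave r i / k ≡ i
  interleave-/ r i = begin
    (toℕ r + i * k) / k   ≡⟨ +-distrib-/-∣ʳ (toℕ r) (divides-refl i) ⟩
    toℕ r / k + i * k / k ≡⟨ cong₂ _+_ (m<n⇒m/n≡0 (toℕ<n r)) (m*n/n≡m i k) ⟩
    i                     ∎
    where open ≡-Reasoning

  %-mod : ∀ {q} .{{_ : NonZero q}} n → k ∣ q → (n % q) mod k ≡ n mod k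
  %-mod {q} n k∣q = toℕ-injective (begin
    toℕ ((n % q) mod k) ≡⟨ toℕ-fromℕ< (m%n<n (n % q) k) ⟩
    n % q % k           ≡⟨ m∣n⇒o%n%m≡o%m k q n k∣q ⟩
    n % k               ≡⟨ toℕ-fromℕ< (m%n<n n k) ⟨
    toℕ (n mod k)       ∎)
    where open ≡-Reasoning

  interleave-% : ∀ p .{{_ : NonZero p}} r i →
                 interleave r i % p ≡ interleave r (i % p) % p
  interleave-% p r i = begin
    (toℕ r + i * k) % p                     ≡⟨ cong (λ j → (toℕ r + j * k) % p) (m≡m%n+[m/n]*n i p) ⟩
    (toℕ r + (i % p + i / p * p) * k) % p   ≡⟨ cong (_% p) (regroup (toℕ r) (i % p) (i / p) p k) ⟩
    (toℕ r + i % p * k + i / p * k * p) % p ≡⟨ [m+kn]%n≡m%n (toℕ r + i % p * k) (i / p * k) p ⟩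
    (toℕ r + i % p * k) % p                 ∎
    where
    open ≡-Reasoning
    regroup : ∀ r a b p k → r + (a + b * p) * k ≡ r + a * k + b * k * p
    regroup = solve-∀

-- suc (commonPeriod ms) = ∏ⱼ suc (ms j)
commonPeriod : ∀ {n} → (Fin n → ℕ) → ℕ
commonPeriod {zero}  ms = 0
commonPeriod {suc n} ms = let m = commonPeriod (ms ∘ suc) in m + ms zero * suc m

suc-∣-suc-commonPeriod : ∀ {n} (ms : Fin n → ℕ) j → suc (ms j) ∣ suc (commonPeriod ms)
suc-∣-suc-commonPeriod {suc n} ms zero    = m∣m*n (suc (commonPeriod (ms ∘ suc)))
suc-∣-suc-commonPeriod {suc n} ms (suc j) =
  ∣-trans (suc-∣-suc-commonPeriod (ms ∘ suc) j) (n∣m*n (suc (ms zero)))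

module _ {σ : Signature} (A : Structure σ) where
  open Structure A
  open SetoidReasoning setoid

  -- Periodic A a ≡ Σ ℕ (HasPeriod a), with the period offset by one.
  HasPeriod : (ℕ → Carrier) → ℕ → Set
  HasPeriod a m = ∀ i → a i ≈ a (i % suc m)

  hasPeriod-∣ : ∀ {a m M} → suc m ∣ suc M → HasPeriod a m → HasPeriod a M
  hasPeriod-∣ {a} {m} {M} m∣M h i = begin
    a i                     ≈⟨ h i ⟩
    a (i % suc m)           ≡⟨ cong a (m∣n⇒o%n%m≡o%m (suc m) (suc M) i m∣M) ⟨
    a (i % suc M % suc m)   ≈⟨ h (i % suc M) ⟨
    a (i % suc M)           ∎

  module _ (k' : ℕ) where
    open Interleaving (suc k')

    private
      k = suc k'
      PA = periodicPower A
      PK = power (Fin k) PA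

    hasPeriod-∘-interleave : ∀ {a m} r → HasPeriod a m → HasPeriod (a ∘ interleave r) m
    hasPeriod-∘-interleave {a} {m} r h i = begin
      a (interleave r i)                         ≈⟨ h (interleave r i) ⟩
      a (interleave r i % suc m)                 ≡⟨ cong a (interleave-% (suc m) r i) ⟩
      a (interleave r (i % suc m) % suc m)       ≈⟨ h (interleave r (i % suc m)) ⟨
      a (interleave r (i % suc m))               ∎

    merge : (Fin k → ℕ → Carrier) → ℕ → Carrier
    merge b n = b (n mod k) (n / k)

    -- suc (k' + m * k) = suc m * k
    hasPeriod-merge : ∀ {b m} → (∀ r → HasPeriod (b r) m) → HasPeriod (merge b) (k' + m * k)
    hasPeriod-merge {b} {m} h n = begin
      b (n mod k) (n / k)                        ≈⟨ h (n mod k) (n / k) ⟩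
      b (n mod k) (n / k % suc m)                ≡⟨ cong₂ b (%-mod n (n∣m*n (suc m))) (m%[n*o]/o≡m/o%n n (suc m) k) ⟨
      b ((n % P) mod k) (n % P / k)              ∎
      where P = suc m * k

    split-periodic : Structure.Carrier PA → Structure.Carrier PK
    split-periodic (a , m , h) r = a ∘ interleave r , m , hasPeriod-∘-interleave r h

    merge-periodic : Structure.Carrier PK → Structure.Carrier PA
    merge-periodic b =
      merge (proj₁ ∘ b) , k' + M * k ,
      hasPeriod-merge (λ r → hasPeriod-∣ (suc-∣-suc-commonPeriod periods r) (proj₂ (proj₂ (b r))))
      where
      periods = proj₁ ∘ proj₂ ∘ b
      M = commonPeriod periods

    periodicPower≅power : PA ≅ PK
    periodicPower≅power = record
      { to        = split-periodic
      ; from      = merge-periodic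
      ; to-cong   = λ p r i → p (interleave r i)
      ; from-cong = λ p n → p (n mod k) (n / k)
      ; from-to   = λ (a , _) n → reflexive (cong a (interleave-mod-/ n))
      ; to-from   = λ b r i →
          reflexive (cong₂ (proj₁ ∘ b) (interleave-mod r i) (interleave-/ r i))
      ; to-fun    = λ _ _ _ _ → refl
      ; to-rel    = λ R xs → mk⇔
          (λ h r i → h (interleave r i))
          (λ h n → rel-resp R (λ j → reflexive (cong (proj₁ (xs j)) (interleave-mod-/ n)))
                                (h (n mod k) (n / k)))
      }

proposition4p5 : ∀ {σ : Signature} (A : Structure σ) (k : ℕ) → 1 < k →
    periodicPower A ≅ power (Fin k) (periodicPower A)
proposition4p5 A (suc k') _ = periodicPower≅power A k'
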